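{- Let $q$ be a prime power and $A,\Theta\subseteq\mathbb{F}_q$. Suppose that $|A|^2|\Theta|>q^2$. Then there exists $\theta\in\Theta$ such that $|A+\theta A|>q/2$. Consequently: (i) if $|A|>q^{2/3}$, there exists $a\in A$ such that $|aA+A|>q/2$; (ii) if $|A|^2|AA^{ -1}|>q^2$, there exist $a,b\in A$ such that $|aA+bA|>q/2$.
   Context: For $X,Y\subseteq\mathbb{F}_q$ and $c\in\mathbb{F}_q$: $X+Y=\{x+y:x\in X,y\in Y\}$, $cX=\{cx:x\in X\}$. $AA^{ -1}=\{ab^{ -1}: a,b\in A,\ b\neq 0\}$. -}

module Defs where

open import Level using (0ℓ)
open import Data.Nat using (ℕ)
open import Data.Fin using (Fin)
open import Data.Fin.Subset using (Subset; _∈_)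
open import Data.Fin.Subset.Properties using (_∈?_)
open import Data.Fin.Properties using (any?)
open import Data.Vec using (tabulate)
open import Data.Product using (∃; _×_; _,_)
open import Relation.Nullary using (¬_; Dec; does; _×-dec_)
open import Relation.Nullary.Decidable using (¬?)
open import Relation.Binary.PropositionalEquality using (_≡_)
open import Relation.Binary using (Decidable)
open import Algebra.Bundles using (CommutativeRing)

record FiniteField (q : ℕ) : Set₁ where
  field
    commRing : CommutativeRing 0ℓ 0ℓ
  open CommutativeRing commRing public
  field
    _≈?_     : Decidable _≈_
    0≉1      : ¬ (0# ≈ 1#)
    inverse  : ∀ x → ¬ (x ≈ 0#) → ∃ λ y → x * y ≈ 1#
    elem     : Fin q → Carrier
    elem-inj : ∀ i j → elem i ≈ elem j → i ≡ j
    elem-sur : ∀ x → ∃ λ i → elem i ≈ x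

-- Subsets of F_q are subsets of Fin q, read through the enumeration  elem .
module _ {q : ℕ} (F : FiniteField q) where
  open FiniteField F

  linComb : Carrier → Subset q → Carrier → Subset q → Subset q
  linComb c X d Y = tabulate λ z →
    does (any? λ i → any? λ j →
      (i ∈? X) ×-dec ((j ∈? Y) ×-dec ((c * elem i + d * elem j) ≈? elem z)))

  -- X X⁻¹ = { x y⁻¹ : x, y ∈ X, y ≠ 0 };  z = x y⁻¹  iff  z y = x  (y ≠ 0)
  ratioSet : Subset q → Subset q
  ratioSet X = tabulate λ z →
    does (any? λ i → any? λ j →
      (i ∈? X) ×-dec ((j ∈? X) ×-dec (¬? (elem j ≈? 0#) ×-dec ((elem z * elem j) ≈? elem i))))

-- For θ ∈ F_q let r_θ(x) be the number of (a, b) ∈ A² with a + θb = x, and E(θ) = Σ_x r_θ(x)² the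
-- energy. Cauchy–Schwarz on the support of r_θ gives |A|⁴ ≤ E(θ) |A + θA| ≤ E(θ) q. Two distinct pairs
-- satisfy a + θb = a' + θb' for at most one θ, so Σ_θ E(θ) ≤ q |A|² + |A|⁴. If |A + θA| ≤ q/2 for all
-- θ ∈ Θ, averaging these bounds gives |A|² |Θ| ≤ q². Parts (i) and (ii) take Θ = A and Θ = AA⁻¹, since
-- A + θA has the size of θA + A and, for θ = a/b, of b(A + θA) = bA + aA.
module Submission where

open import Defs
open import Data.Nat using (ℕ)
open import Data.Bool using (Bool; true; false)
open import Data.Empty using (⊥-elim)
open import Data.Fin using (Fin; zero; suc)
open import Data.Fin.Properties as Finₚ using (any?)
open import Data.Fin.Permutation using (Permutation′; permutation; _⟨$⟩ʳ_)
open import Data.Fin.Subset using (Subset; _∈_; _∉_; _⊆_; ∣_∣)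
open import Data.Fin.Subset.Properties using (_∈?_; ∣p∣≤n; p⊆q⇒∣p∣≤∣q∣)
open import Data.Product using (∃; ∃₂; _×_; _,_; proj₁; proj₂)
open import Data.Sum using (inj₁; inj₂)
open import Data.Vec using ([]; _∷_; lookup; tabulate)
open import Data.Vec.Functional using (Vector)
open import Data.Vec.Properties using (lookup∘tabulate; []=⇒lookup; lookup⇒[]=)
open import Function using (_∘_; case_of_)
open import Relation.Nullary using (¬_; Dec; yes; no; does; _×-dec_)
open import Relation.Nullary.Decidable using (dec-true; ¬?)
open import Relation.Binary.PropositionalEquality as ≡ using (_≡_)
open import Algebra.Definitions using (AlmostRightCancellative)
import Algebra.Properties.Group as GroupProperties

dec-true⁻¹ : ∀ {P : Set} (P? : Dec P) → does P? ≡ true → P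
dec-true⁻¹ (yes p) _ = p

∈-tabulate⁺ : ∀ {n} {P : Fin n → Set} (P? : ∀ z → Dec (P z)) {z} → P z → z ∈ tabulate (does ∘ P?)
∈-tabulate⁺ P? {z} p = lookup⇒[]= z _ (≡.trans (lookup∘tabulate (does ∘ P?) z) (dec-true (P? z) p))

∈-tabulate⁻ : ∀ {n} {P : Fin n → Set} (P? : ∀ z → Dec (P z)) {z} → z ∈ tabulate (does ∘ P?) → P z
∈-tabulate⁻ P? {z} z∈ = dec-true⁻¹ (P? z) (≡.trans (≡.sym (lookup∘tabulate (does ∘ P?) z)) ([]=⇒lookup z∈))

module FiniteFieldProperties {q : ℕ} (F : FiniteField q) where
  open FiniteField F
  open GroupProperties +-group using (//-rightDividesˡ; ∙-cancelˡ; ∙-cancelʳ; x∙y⁻¹≈ε⇒x≈y)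
  open import Relation.Binary.Reasoning.Setoid setoid

  *-almostCancelʳ : AlmostRightCancellative _≈_ 0# _*_
  *-almostCancelʳ x y z x≉0 yx≈zx with x⁻¹ , xx⁻¹≈1 ← inverse x x≉0 = begin
    y               ≈⟨ *-identityʳ y ⟨
    y * 1#          ≈⟨ *-congˡ xx⁻¹≈1 ⟨
    y * (x * x⁻¹)   ≈⟨ *-assoc y x x⁻¹ ⟨
    y * x * x⁻¹     ≈⟨ *-congʳ yx≈zx ⟩
    z * x * x⁻¹     ≈⟨ *-assoc z x x⁻¹ ⟩
    z * (x * x⁻¹)   ≈⟨ *-congˡ xx⁻¹≈1 ⟩
    z * 1#          ≈⟨ *-identityʳ z ⟩
    z               ∎

  translate-injective : ∀ {a a' c} → 1# * a + c ≈ 1# * a' + c → a ≈ a'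
  translate-injective {a} {a'} {c} eq = begin
    a       ≈⟨ *-identityˡ a ⟨
    1# * a  ≈⟨ ∙-cancelʳ c _ _ eq ⟩
    1# * a' ≈⟨ *-identityˡ a' ⟩
    a'      ∎

  -- Both relations rewrite to o + t (y - y') ≈ o' and o + s (y - y') ≈ o', and y - y' is invertible.
  dilation-unique : ∀ {o o' t s y y'} → ¬ y ≈ y' →
    o + t * y ≈ o' + t * y' → o + s * y ≈ o' + s * y' → t ≈ s
  dilation-unique {o} {y = y} {y'} y≉y' eqt eqs =
    *-almostCancelʳ (y - y') _ _ (y≉y' ∘ x∙y⁻¹≈ε⇒x≈y y y')
      (∙-cancelˡ o _ _ (trans (absorb eqt) (sym (absorb eqs))))
    where
    absorb : ∀ {o o' t} → o + t * y ≈ o' + t * y' → o + t * (y - y') ≈ o'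
    absorb {o} {o'} {t} eq = ∙-cancelʳ (t * y') _ _ (begin
      o + t * (y - y') + t * y'   ≈⟨ +-assoc o _ _ ⟩
      o + (t * (y - y') + t * y') ≈⟨ +-congˡ (distribˡ t (y - y') y') ⟨
      o + t * (y - y' + y')       ≈⟨ +-congˡ (*-congˡ (//-rightDividesˡ y' y)) ⟩
      o + t * y                   ≈⟨ eq ⟩
      o' + t * y'                 ∎)

  index : Carrier → Fin q
  index x = proj₁ (elem-sur x)

  elem-index : ∀ x → elem (index x) ≈ x
  elem-index x = proj₂ (elem-sur x)

  linComb? : ∀ c X d Y z → Dec (∃₂ λ i j → i ∈ X × j ∈ Y × c * elem i + d * elem j ≈ elem z)
  linComb? c X d Y z = any? λ i → any? λ j →
    (i ∈? X) ×-dec ((j ∈? Y) ×-dec ((c * elem i + d * elem j) ≈? elem z))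

  ratioSet? : ∀ X z → Dec (∃₂ λ i j → i ∈ X × j ∈ X × ¬ elem j ≈ 0# × elem z * elem j ≈ elem i)
  ratioSet? X z = any? λ i → any? λ j →
    (i ∈? X) ×-dec ((j ∈? X) ×-dec (¬? (elem j ≈? 0#) ×-dec ((elem z * elem j) ≈? elem i)))

  ∈-linComb⁺ : ∀ {c d X Y z} i j → i ∈ X → j ∈ Y → c * elem i + d * elem j ≈ elem z →
               z ∈ linComb F c X d Y
  ∈-linComb⁺ {c} {d} {X} {Y} i j i∈X j∈Y eq = ∈-tabulate⁺ (linComb? c X d Y) (i , j , i∈X , j∈Y , eq)

  ∈-linComb⁻ : ∀ {c d X Y z} → z ∈ linComb F c X d Y →
               ∃₂ λ i j → i ∈ X × j ∈ Y × c * elem i + d * elem j ≈ elem z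
  ∈-linComb⁻ {c} {d} {X} {Y} = ∈-tabulate⁻ (linComb? c X d Y)

  ∈-ratioSet⁻ : ∀ {X z} → z ∈ ratioSet F X →
                ∃₂ λ i j → i ∈ X × j ∈ X × ¬ elem j ≈ 0# × elem z * elem j ≈ elem i
  ∈-ratioSet⁻ {X} = ∈-tabulate⁻ (ratioSet? X)

  linComb-comm : ∀ c X d Y → linComb F c X d Y ⊆ linComb F d Y c X
  linComb-comm c X d Y z∈ with i , j , i∈X , j∈Y , eq ← ∈-linComb⁻ z∈ =
    ∈-linComb⁺ j i j∈Y i∈X (trans (+-comm _ _) eq)

  *-permutation : ∀ {u} → ¬ u ≈ 0# → Permutation′ q
  *-permutation {u} u≉0 = permutation (λ z → index (u * elem z)) (λ w → index (u⁻¹ * elem w))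
    (λ w → elem-inj _ w (cancel u u⁻¹ uu⁻¹≈1 (elem w)))
    (λ z → elem-inj _ z (cancel u⁻¹ u (trans (*-comm u⁻¹ u) uu⁻¹≈1) (elem z)))
    where
    u⁻¹ = proj₁ (inverse u u≉0)
    uu⁻¹≈1 : u * u⁻¹ ≈ 1#
    uu⁻¹≈1 = proj₂ (inverse u u≉0)
    cancel : ∀ a b → a * b ≈ 1# → ∀ x → elem (index (a * elem (index (b * x)))) ≈ x
    cancel a b ab≈1 x = begin
      elem (index (a * elem (index (b * x)))) ≈⟨ elem-index _ ⟩
      a * elem (index (b * x))                ≈⟨ *-congˡ (elem-index _) ⟩
      a * (b * x)                             ≈⟨ *-assoc a b x ⟨
      a * b * x                               ≈⟨ *-congʳ ab≈1 ⟩
      1# * x                                  ≈⟨ *-identityˡ x ⟩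
      x                                       ∎

  linComb-*-permutation : ∀ {u c c' d d' X Y z} (u≉0 : ¬ u ≈ 0#) → u * c ≈ c' → u * d ≈ d' →
    z ∈ linComb F c X d Y → *-permutation u≉0 ⟨$⟩ʳ z ∈ linComb F c' X d' Y
  linComb-*-permutation {u} {c} {c'} {d} {d'} {z = z} u≉0 uc≈c' ud≈d' z∈
    with i , j , i∈X , j∈Y , eq ← ∈-linComb⁻ z∈ = ∈-linComb⁺ i j i∈X j∈Y (begin
      c' * elem i + d' * elem j           ≈⟨ +-cong (*-congʳ uc≈c') (*-congʳ ud≈d') ⟨
      u * c * elem i + u * d * elem j     ≈⟨ +-cong (*-assoc u c _) (*-assoc u d _) ⟩
      u * (c * elem i) + u * (d * elem j) ≈⟨ distribˡ u _ _ ⟨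
      u * (c * elem i + d * elem j)       ≈⟨ *-congˡ eq ⟩
      u * elem z                          ≈⟨ elem-index _ ⟨
      elem (index (u * elem z))           ∎)

-- Imported only here: the ring operations of FiniteFieldProperties share these names.
open import Data.Nat using (zero; suc; _+_; _*_; _^_; _≤_; _<_; _<?_; _>_; z≤n)
open import Data.Nat.Properties
open import Data.Nat.Solver using (module +-*-Solver)
open import Algebra.Properties.Semiring.Sum +-*-semiring
  using ( sum; sum-syntax; sum-cong-≗; sum-replicate-zero; ∑-comm; ∑-distrib-+; ∑-permute
        ; *-distribˡ-sum; *-distribʳ-sum)
open ≡ using (refl; sym; trans; cong; cong₂; subst; subst₂)
open +-*-Solver using (solve; _:+_; _:*_; _:=_; con)

𝟙 : Bool → ℕ
𝟙 true  = 1
𝟙 false = 0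

𝟙≤1 : ∀ b → 𝟙 b ≤ 1
𝟙≤1 true  = ≤-refl
𝟙≤1 false = z≤n

𝟙*𝟙≡𝟙 : ∀ b → 𝟙 b * 𝟙 b ≡ 𝟙 b
𝟙*𝟙≡𝟙 true  = refl
𝟙*𝟙≡𝟙 false = refl

sum-mono-≤ : ∀ {n} {f g : Vector ℕ n} → (∀ i → f i ≤ g i) → sum f ≤ sum g
sum-mono-≤ {zero}  f≤g = z≤n
sum-mono-≤ {suc n} f≤g = +-mono-≤ (f≤g zero) (sum-mono-≤ (f≤g ∘ suc))

sum-const : ∀ n c → ∑[ i < n ] c ≡ n * c
sum-const zero    c = refl
sum-const (suc n) c = cong (c +_) (sum-const n c)

≤-sum : ∀ {n} (f : Vector ℕ n) i → f i ≤ sum f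
≤-sum f zero    = m≤m+n (f zero) _
≤-sum f (suc i) = ≤-trans (≤-sum (f ∘ suc) i) (m≤n+m _ (f zero))

sum-*-sum : ∀ {m n} (f : Vector ℕ m) (g : Vector ℕ n) →
            sum f * sum g ≡ ∑[ i < m ] ∑[ j < n ] (f i * g j)
sum-*-sum f g = trans (*-distribʳ-sum (sum g) f) (sum-cong-≗ λ i → *-distribˡ-sum (f i) g)

sum-𝟙-≤1 : ∀ {n} (g : Vector Bool n) → (∀ k l → g k ≡ true → g l ≡ true → k ≡ l) →
           ∑[ k < n ] 𝟙 (g k) ≤ 1
sum-𝟙-≤1 {zero}  g unique = z≤n
sum-𝟙-≤1 {suc n} g unique with g zero in g₀
... | true  = ≤-reflexive (cong suc (trans (sum-cong-≗ rest) (sum-replicate-zero n)))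
  where
  rest : ∀ k → 𝟙 (g (suc k)) ≡ 0
  rest k with g (suc k) in gₖ
  ... | true  with () ← unique zero (suc k) g₀ gₖ
  ... | false = refl
... | false = sum-𝟙-≤1 (g ∘ suc) λ k l gₖ gₗ → Finₚ.suc-injective (unique (suc k) (suc l) gₖ gₗ)

sum-𝟙-≡1 : ∀ {n} (g : Vector Bool n) i → g i ≡ true →
           (∀ k l → g k ≡ true → g l ≡ true → k ≡ l) → ∑[ k < n ] 𝟙 (g k) ≡ 1
sum-𝟙-≡1 g i gᵢ unique = ≤-antisym (sum-𝟙-≤1 g unique)
  (subst (λ b → 𝟙 b ≤ sum (𝟙 ∘ g)) gᵢ (≤-sum (𝟙 ∘ g) i))

sum-𝟙-≟-≤1 : ∀ {n} (i : Fin n) → ∑[ k < n ] 𝟙 (does (k Finₚ.≟ i)) ≤ 1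
sum-𝟙-≟-≤1 i = sum-𝟙-≤1 (λ k → does (k Finₚ.≟ i))
  λ k l k≡i l≡i → trans (dec-true⁻¹ (k Finₚ.≟ i) k≡i) (sym (dec-true⁻¹ (l Finₚ.≟ i) l≡i))

private
  x≤y⇒2xy≤x²+y² : ∀ {x y} → x ≤ y → 2 * (x * y) ≤ x * x + y * y
  x≤y⇒2xy≤x²+y² {x} x≤y with d , refl ← m≤n⇒∃[o]m+o≡n x≤y =
    subst (2 * (x * (x + d)) ≤_)
      (solve 2 (λ x d → con 2 :* (x :* (x :+ d)) :+ d :* d := x :* x :+ (x :+ d) :* (x :+ d)) refl x d)
      (m≤m+n _ (d * d))

2xy≤x²+y² : ∀ x y → 2 * (x * y) ≤ x * x + y * y
2xy≤x²+y² x y with ≤-total x y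
... | inj₁ x≤y = x≤y⇒2xy≤x²+y² x≤y
... | inj₂ y≤x = subst₂ _≤_ (cong (2 *_) (*-comm y x)) (+-comm (y * y) (x * x)) (x≤y⇒2xy≤x²+y² y≤x)

cauchy-schwarz : ∀ {n} (f g : Vector ℕ n) →
  ∑[ i < n ] (f i * g i) * ∑[ i < n ] (f i * g i) ≤ ∑[ i < n ] (f i * f i) * ∑[ i < n ] (g i * g i)
cauchy-schwarz {n} f g = *-cancelˡ-≤ 2 (begin
  2 * (sum fg * sum fg)
    ≡⟨ cong (2 *_) (sum-*-sum fg fg) ⟩
  2 * ∑[ i < n ] ∑[ j < n ] (fg i * fg j)
    ≡⟨ trans (*-distribˡ-sum 2 (λ i → ∑[ j < n ] (fg i * fg j)))
             (sum-cong-≗ λ i → *-distribˡ-sum 2 (λ j → fg i * fg j)) ⟩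
  ∑[ i < n ] ∑[ j < n ] (2 * (fg i * fg j))
    ≡⟨ sum-cong-≗ (λ i → sum-cong-≗ (λ j → rearrange i j)) ⟩
  ∑[ i < n ] ∑[ j < n ] (2 * ((f i * g j) * (f j * g i)))
    ≤⟨ sum-mono-≤ {n} (λ i → sum-mono-≤ {n} (λ j → 2xy≤x²+y² (f i * g j) (f j * g i))) ⟩
  ∑[ i < n ] ∑[ j < n ] (square (f i * g j) + square (f j * g i))
    ≡⟨ sum-cong-≗ (λ i → sum-cong-≗ (λ j → expand i j)) ⟩
  ∑[ i < n ] ∑[ j < n ] (ff i * gg j + ff j * gg i)
    ≡⟨ trans (sum-cong-≗ λ i → ∑-distrib-+ (λ j → ff i * gg j) (λ j → ff j * gg i))
             (∑-distrib-+ (λ i → ∑[ j < n ] (ff i * gg j)) (λ i → ∑[ j < n ] (ff j * gg i))) ⟩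
  ∑[ i < n ] ∑[ j < n ] (ff i * gg j) + ∑[ i < n ] ∑[ j < n ] (ff j * gg i)
    ≡⟨ cong₂ _+_ (sym (sum-*-sum ff gg)) (trans (∑-comm (λ i j → ff j * gg i)) (sym (sum-*-sum ff gg))) ⟩
  sum ff * sum gg + sum ff * sum gg
    ≡⟨ cong (sum ff * sum gg +_) (sym (+-identityʳ _)) ⟩
  2 * (sum ff * sum gg) ∎)
  where
  open ≤-Reasoning
  square : ℕ → ℕ
  square x = x * x
  fg ff gg : Vector ℕ n
  fg i = f i * g i
  ff i = square (f i)
  gg i = square (g i)
  rearrange : ∀ i j → 2 * (fg i * fg j) ≡ 2 * ((f i * g j) * (f j * g i))
  rearrange i j = cong (2 *_)
    (solve 4 (λ a b c d → (a :* b) :* (c :* d) := (a :* d) :* (c :* b)) refl (f i) (g i) (f j) (g j))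
  expand : ∀ i j → square (f i * g j) + square (f j * g i) ≡ ff i * gg j + ff j * gg i
  expand i j = solve 4
    (λ a b c d → (a :* b) :* (a :* b) :+ (c :* d) :* (c :* d) := (a :* a) :* (b :* b) :+ (c :* c) :* (d :* d))
    refl (f i) (g j) (f j) (g i)

∣p∣≡sum-𝟙 : ∀ {n} (p : Subset n) → ∣ p ∣ ≡ ∑[ i < n ] 𝟙 (lookup p i)
∣p∣≡sum-𝟙 []          = refl
∣p∣≡sum-𝟙 (true ∷ p)  = cong suc (∣p∣≡sum-𝟙 p)
∣p∣≡sum-𝟙 (false ∷ p) = ∣p∣≡sum-𝟙 p

cauchy-schwarz-support : ∀ {n} (r : Vector ℕ n) (S : Subset n) → (∀ z → z ∉ S → r z ≡ 0) →
  sum r * sum r ≤ ∑[ z < n ] (r z * r z) * ∣ S ∣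
cauchy-schwarz-support {n} r S vanish =
  subst₂ (λ a b → a * a ≤ ∑[ z < n ] (r z * r z) * b)
    (sum-cong-≗ restrict) (trans (sum-cong-≗ (𝟙*𝟙≡𝟙 ∘ lookup S)) (sym (∣p∣≡sum-𝟙 S)))
    (cauchy-schwarz r (𝟙 ∘ lookup S))
  where
  restrict : ∀ z → r z * 𝟙 (lookup S z) ≡ r z
  restrict z with lookup S z in Sz
  ... | true  = *-identityʳ (r z)
  ... | false = trans (*-zeroʳ (r z)) (sym (vanish z λ z∈S → case trans (sym Sz) ([]=⇒lookup z∈S) of λ ()))

∣p∣≤∣q∣-permute : ∀ {n} {p q : Subset n} (π : Permutation′ n) →
                  (∀ {z} → z ∈ p → π ⟨$⟩ʳ z ∈ q) → ∣ p ∣ ≤ ∣ q ∣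
∣p∣≤∣q∣-permute {n} {p} {q} π p⊆π⁻¹q = begin
  ∣ p ∣                              ≡⟨ ∣p∣≡sum-𝟙 p ⟩
  ∑[ z < n ] 𝟙 (lookup p z)          ≤⟨ sum-mono-≤ pointwise ⟩
  ∑[ z < n ] 𝟙 (lookup q (π ⟨$⟩ʳ z)) ≡⟨ ∑-permute (𝟙 ∘ lookup q) π ⟨
  ∑[ z < n ] 𝟙 (lookup q z)          ≡⟨ ∣p∣≡sum-𝟙 q ⟨
  ∣ q ∣                              ∎
  where
  open ≤-Reasoning
  pointwise : ∀ z → 𝟙 (lookup p z) ≤ 𝟙 (lookup q (π ⟨$⟩ʳ z))
  pointwise z with lookup p z in pz
  ... | false = z≤n
  ... | true  rewrite []=⇒lookup (p⊆π⁻¹q (lookup⇒[]= z p pz)) = ≤-refl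

∑-comm₂ : ∀ {l m n} (f : Fin l → Fin m → Fin n → ℕ) →
  ∑[ z < l ] ∑[ i < m ] ∑[ j < n ] f z i j ≡ ∑[ i < m ] ∑[ j < n ] ∑[ z < l ] f z i j
∑-comm₂ f = trans (∑-comm (λ z i → ∑[ j < _ ] f z i j)) (sum-cong-≗ λ i → ∑-comm (λ z j → f z i j))

-- If 2 s t ≤ q on Θ, summing M² ≤ E t · s t over Θ and M² ≤ E t · q elsewhere gives
-- q M² + |Θ| M² ≤ q Σ E ≤ q² M + q M², that is |Θ| M ≤ q².
exists-large-of-energy : ∀ {q} (M : ℕ) (E s : Vector ℕ q) (Θ : Subset q) →
  (∀ t → M * M ≤ E t * s t) → (∀ t → s t ≤ q) → sum E ≤ M * (q + M) →
  q * q < M * ∣ Θ ∣ → ∃ λ t → t ∈ Θ × q < 2 * s t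
exists-large-of-energy zero E s Θ _ _ _ ()
exists-large-of-energy {q} M@(suc _) E s Θ lower s≤q upper many
  with any? (λ t → (t ∈? Θ) ×-dec (q <? 2 * s t))
... | yes found = found
... | no none = ⊥-elim (<⇒≱ many (*-cancelʳ-≤ (M * ∣ Θ ∣) (q * q) M few))
  where
  open ≤-Reasoning
  pointwise : ∀ t → M * M + 𝟙 (lookup Θ t) * (M * M) ≤ E t * q
  pointwise t with lookup Θ t in t∈Θ
  ... | false = ≤-trans (≤-reflexive (+-identityʳ (M * M))) (≤-trans (lower t) (*-monoʳ-≤ (E t) (s≤q t)))
  ... | true  = begin
    2 * (M * M)       ≤⟨ *-monoʳ-≤ 2 (lower t) ⟩
    2 * (E t * s t)   ≡⟨ solve 2 (λ e s → con 2 :* (e :* s) := e :* (con 2 :* s)) refl (E t) (s t) ⟩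
    E t * (2 * s t)   ≤⟨ *-monoʳ-≤ (E t) (≮⇒≥ λ q<2s → none (t , lookup⇒[]= t Θ t∈Θ , q<2s)) ⟩
    E t * q           ∎
  few : M * ∣ Θ ∣ * M ≤ q * q * M
  few = +-cancelˡ-≤ (q * (M * M)) _ _ (begin
    q * (M * M) + M * ∣ Θ ∣ * M
      ≡⟨ cong₂ _+_ (sym (sum-const q (M * M)))
           (trans (solve 2 (λ m t → m :* t :* m := t :* (m :* m)) refl M ∣ Θ ∣)
             (trans (cong (_* (M * M)) (∣p∣≡sum-𝟙 Θ)) (*-distribʳ-sum (M * M) (𝟙 ∘ lookup Θ)))) ⟩
    ∑[ t < q ] (M * M) + ∑[ t < q ] (𝟙 (lookup Θ t) * (M * M))
      ≡⟨ ∑-distrib-+ (λ _ → M * M) (λ t → 𝟙 (lookup Θ t) * (M * M)) ⟨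
    ∑[ t < q ] (M * M + 𝟙 (lookup Θ t) * (M * M))
      ≤⟨ sum-mono-≤ pointwise ⟩
    ∑[ t < q ] (E t * q)
      ≡⟨ *-distribʳ-sum q E ⟨
    sum E * q
      ≤⟨ *-monoˡ-≤ q upper ⟩
    M * (q + M) * q
      ≡⟨ solve 2 (λ m q → m :* (q :+ m) :* q := q :* (m :* m) :+ q :* q :* m) refl M q ⟩
    q * (M * M) + q * q * M ∎)

module Fibres {q : ℕ} (F : FiniteField q) where
  open FiniteField F using (Carrier; _≈_; _≈?_; elem; elem-inj) renaming (sym to ≈-sym; trans to ≈-trans)
  open FiniteFieldProperties F using (index; elem-index)
  open ≡.≡-Reasoning

  δ : Carrier → Carrier → ℕ
  δ x y = 𝟙 (does (x ≈? y))

  δ-congʳ : ∀ {x y y'} → y ≈ y' → δ x y ≡ δ x y'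
  δ-congʳ {x} {y} {y'} y≈y' with x ≈? y | x ≈? y'
  ... | yes _   | yes _    = refl
  ... | no _    | no _     = refl
  ... | yes x≈y | no x≉y'  = ⊥-elim (x≉y' (≈-trans x≈y y≈y'))
  ... | no x≉y  | yes x≈y' = ⊥-elim (x≉y (≈-trans x≈y' (≈-sym y≈y')))

  ∑-δ-elem : ∀ x → ∑[ z < q ] δ x (elem z) ≡ 1
  ∑-δ-elem x = sum-𝟙-≡1 (λ z → does (x ≈? elem z)) (index x) (dec-true (x ≈? _) (≈-sym (elem-index x)))
    λ k l x≈k x≈l → elem-inj k l
      (≈-trans (≈-sym (dec-true⁻¹ (x ≈? elem k) x≈k)) (dec-true⁻¹ (x ≈? elem l) x≈l))

  δ-sift : ∀ (G : Carrier → ℕ) → (∀ {y y'} → y ≈ y' → G y ≡ G y') → ∀ x →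
           ∑[ z < q ] (δ x (elem z) * G (elem z)) ≡ G x
  δ-sift G G-cong x = begin
    ∑[ z < q ] (δ x (elem z) * G (elem z)) ≡⟨ sum-cong-≗ pointwise ⟩
    ∑[ z < q ] (δ x (elem z) * G x)        ≡⟨ *-distribʳ-sum (G x) (λ z → δ x (elem z)) ⟨
    ∑[ z < q ] δ x (elem z) * G x          ≡⟨ cong (_* G x) (∑-δ-elem x) ⟩
    1 * G x                                ≡⟨ *-identityˡ (G x) ⟩
    G x                                    ∎
    where
    pointwise : ∀ z → δ x (elem z) * G (elem z) ≡ δ x (elem z) * G x
    pointwise z with x ≈? elem z
    ... | yes x≈z = cong (1 *_) (G-cong (≈-sym x≈z))
    ... | no _    = refl

  module _ (w : Fin q → Fin q → ℕ) (p : Fin q → Fin q → Carrier) where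

    fibre : Carrier → ℕ
    fibre x = ∑[ i < q ] ∑[ j < q ] (w i j * δ (p i j) x)

    fibre-cong : ∀ {x y} → x ≈ y → fibre x ≡ fibre y
    fibre-cong x≈y = sum-cong-≗ λ i → sum-cong-≗ λ j → cong (w i j *_) (δ-congʳ x≈y)

    ∑-fibre : ∑[ z < q ] fibre (elem z) ≡ ∑[ i < q ] ∑[ j < q ] w i j
    ∑-fibre = begin
      ∑[ z < q ] ∑[ i < q ] ∑[ j < q ] (w i j * δ (p i j) (elem z))
        ≡⟨ ∑-comm₂ (λ z i j → w i j * δ (p i j) (elem z)) ⟩
      ∑[ i < q ] ∑[ j < q ] ∑[ z < q ] (w i j * δ (p i j) (elem z))
        ≡⟨ sum-cong-≗ (λ i → sum-cong-≗ (λ j → weighted i j)) ⟩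
      ∑[ i < q ] ∑[ j < q ] w i j ∎
      where
      weighted : ∀ i j → ∑[ z < q ] (w i j * δ (p i j) (elem z)) ≡ w i j
      weighted i j = begin
        ∑[ z < q ] (w i j * δ (p i j) (elem z)) ≡⟨ *-distribˡ-sum (w i j) (λ z → δ (p i j) (elem z)) ⟨
        w i j * ∑[ z < q ] δ (p i j) (elem z)   ≡⟨ cong (w i j *_) (∑-δ-elem (p i j)) ⟩
        w i j * 1                               ≡⟨ *-identityʳ (w i j) ⟩
        w i j                                   ∎

    ∑-fibre² : ∑[ z < q ] (fibre (elem z) * fibre (elem z)) ≡ ∑[ i < q ] ∑[ j < q ] (w i j * fibre (p i j))
    ∑-fibre² = begin
      ∑[ z < q ] (fibre (elem z) * fibre (elem z))
        ≡⟨ sum-cong-≗ (λ z → expand (fibre (elem z)) z) ⟩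
      ∑[ z < q ] ∑[ i < q ] ∑[ j < q ] (w i j * δ (p i j) (elem z) * fibre (elem z))
        ≡⟨ ∑-comm₂ (λ z i j → w i j * δ (p i j) (elem z) * fibre (elem z)) ⟩
      ∑[ i < q ] ∑[ j < q ] ∑[ z < q ] (w i j * δ (p i j) (elem z) * fibre (elem z))
        ≡⟨ sum-cong-≗ (λ i → sum-cong-≗ (λ j → sift i j)) ⟩
      ∑[ i < q ] ∑[ j < q ] (w i j * fibre (p i j)) ∎
      where
      expand : ∀ c z → fibre (elem z) * c ≡ ∑[ i < q ] ∑[ j < q ] (w i j * δ (p i j) (elem z) * c)
      expand c z = trans (*-distribʳ-sum c (λ i → ∑[ j < q ] (w i j * δ (p i j) (elem z))))
        (sum-cong-≗ λ i → *-distribʳ-sum c (λ j → w i j * δ (p i j) (elem z)))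
      sift : ∀ i j → ∑[ z < q ] (w i j * δ (p i j) (elem z) * fibre (elem z)) ≡ w i j * fibre (p i j)
      sift i j = begin
        ∑[ z < q ] (w i j * δ (p i j) (elem z) * fibre (elem z))
          ≡⟨ sum-cong-≗ (λ z → *-assoc (w i j) (δ (p i j) (elem z)) (fibre (elem z))) ⟩
        ∑[ z < q ] (w i j * (δ (p i j) (elem z) * fibre (elem z)))
          ≡⟨ *-distribˡ-sum (w i j) (λ z → δ (p i j) (elem z) * fibre (elem z)) ⟨
        w i j * ∑[ z < q ] (δ (p i j) (elem z) * fibre (elem z))
          ≡⟨ cong (w i j *_) (δ-sift fibre fibre-cong (p i j)) ⟩
        w i j * fibre (p i j) ∎

module Dilations {q : ℕ} (F : FiniteField q) (A : Subset q) where
  open FiniteField F using (Carrier; _≈?_; elem; elem-inj; 1#) renaming (_+_ to _+ᶠ_; _*_ to _*ᶠ_)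
  open FiniteFieldProperties F
    using ( translate-injective; dilation-unique; ∈-linComb⁺; ∈-ratioSet⁻; linComb-comm
          ; *-permutation; linComb-*-permutation)
  module 𝔽 = FiniteField F
  open Fibres F
  open ≤-Reasoning

  weight : Fin q → Fin q → ℕ
  weight i j = 𝟙 (lookup A i) * 𝟙 (lookup A j)

  point : Fin q → Fin q → Fin q → Carrier
  point t i j = 1# *ᶠ elem i +ᶠ elem t *ᶠ elem j

  A+θA : Fin q → Subset q
  A+θA t = linComb F 1# A (elem t) A

  rep : Fin q → Carrier → ℕ
  rep t = fibre weight (point t)

  energy : Fin q → ℕ
  energy t = ∑[ z < q ] (rep t (elem z) * rep t (elem z))

  ∑-weight : ∑[ i < q ] ∑[ j < q ] weight i j ≡ ∣ A ∣ * ∣ A ∣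
  ∑-weight = trans (sym (sum-*-sum (𝟙 ∘ lookup A) (𝟙 ∘ lookup A))) (sym (cong₂ _*_ (∣p∣≡sum-𝟙 A) (∣p∣≡sum-𝟙 A)))

  weight≤1 : ∀ i j → weight i j ≤ 1
  weight≤1 i j = *-mono-≤ (𝟙≤1 (lookup A i)) (𝟙≤1 (lookup A j))

  rep-support : ∀ t z → z ∉ A+θA t → rep t (elem z) ≡ 0
  rep-support t z z∉ =
    trans (sum-cong-≗ λ i → trans (sum-cong-≗ (vanish i)) (sum-replicate-zero q)) (sum-replicate-zero q)
    where
    vanish : ∀ i j → 𝟙 (lookup A i) * 𝟙 (lookup A j) * 𝟙 (does (point t i j ≈? elem z)) ≡ 0
    vanish i j with lookup A i in i∈A | lookup A j in j∈A | point t i j ≈? elem z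
    ... | true  | true  | yes eq = ⊥-elim (z∉ (∈-linComb⁺ i j (lookup⇒[]= i A i∈A) (lookup⇒[]= j A j∈A) eq))
    ... | true  | true  | no _   = refl
    ... | true  | false | _      = refl
    ... | false | _     | _      = refl

  energy-lower : ∀ t → (∣ A ∣ * ∣ A ∣) * (∣ A ∣ * ∣ A ∣) ≤ energy t * ∣ A+θA t ∣
  energy-lower t = subst (λ n → n * n ≤ energy t * ∣ A+θA t ∣) (trans (∑-fibre weight (point t)) ∑-weight)
    (cauchy-schwarz-support (rep t ∘ elem) (A+θA t) (rep-support t))

  same : Fin q → Fin q → ℕ
  same k i = 𝟙 (does (k Finₚ.≟ i))

  dilations-collide : ∀ i j k l → ∑[ t < q ] δ (point t k l) (point t i j) ≤ q * (same k i * same l j) + 1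
  dilations-collide i j k l with k Finₚ.≟ i | l Finₚ.≟ j
  ... | yes refl | yes refl = begin
    ∑[ t < q ] δ (point t i j) (point t i j) ≤⟨ sum-mono-≤ (λ t → 𝟙≤1 (does (point t i j ≈? point t i j))) ⟩
    ∑[ t < q ] 1                             ≡⟨ sum-const q 1 ⟩
    q * 1                                    ≤⟨ m≤m+n (q * 1) 1 ⟩
    q * 1 + 1                                ∎
  ... | no k≢i | yes refl = ≤-trans (sum-𝟙-≤1 _ none) (m≤n+m 1 _)
    where
    none : ∀ t s → does (point t k j ≈? point t i j) ≡ true → _ → t ≡ s
    none t _ collide _ = ⊥-elim (k≢i (elem-inj k i (translate-injective (dec-true⁻¹ (_ ≈? _) collide))))
  ... | _ | no l≢j = ≤-trans (sum-𝟙-≤1 _ at-most-one) (m≤n+m 1 _)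
    where
    at-most-one : ∀ t s → does (point t k l ≈? point t i j) ≡ true →
                  does (point s k l ≈? point s i j) ≡ true → t ≡ s
    at-most-one t s collideₜ collideₛ = elem-inj t s
      (dilation-unique (l≢j ∘ elem-inj l j) (dec-true⁻¹ (_ ≈? _) collideₜ) (dec-true⁻¹ (_ ≈? _) collideₛ))

  weighted-collisions : ∀ i j k l →
    weight k l * ∑[ t < q ] δ (point t k l) (point t i j) ≤ q * (same k i * same l j) + weight k l
  weighted-collisions i j k l = begin
    weight k l * ∑[ t < q ] δ (point t k l) (point t i j) ≤⟨ *-monoʳ-≤ (weight k l) (dilations-collide i j k l) ⟩
    weight k l * (c + 1)                                  ≡⟨ *-distribˡ-+ (weight k l) c 1 ⟩
    weight k l * c + weight k l * 1                       ≤⟨ +-mono-≤ (*-monoˡ-≤ c (weight≤1 k l))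
                                                                      (≤-reflexive (*-identityʳ (weight k l))) ⟩
    1 * c + weight k l                                    ≡⟨ cong (_+ weight k l) (*-identityˡ c) ⟩
    c + weight k l                                        ∎
    where c = q * (same k i * same l j)

  ∑-rep-at-point : ∀ i j → ∑[ t < q ] rep t (point t i j) ≤ q + ∣ A ∣ * ∣ A ∣
  ∑-rep-at-point i j = begin
    ∑[ t < q ] ∑[ k < q ] ∑[ l < q ] (weight k l * δ (point t k l) (point t i j))
      ≡⟨ ∑-comm₂ (λ t k l → weight k l * δ (point t k l) (point t i j)) ⟩
    ∑[ k < q ] ∑[ l < q ] ∑[ t < q ] (weight k l * δ (point t k l) (point t i j))
      ≡⟨ sum-cong-≗ (λ k → sum-cong-≗ λ l → *-distribˡ-sum (weight k l) (λ t → δ (point t k l) (point t i j))) ⟨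
    ∑[ k < q ] ∑[ l < q ] (weight k l * ∑[ t < q ] δ (point t k l) (point t i j))
      ≤⟨ sum-mono-≤ (λ k → sum-mono-≤ λ l → weighted-collisions i j k l) ⟩
    ∑[ k < q ] ∑[ l < q ] (q * (same k i * same l j) + weight k l)
      ≡⟨ trans (sum-cong-≗ λ k → ∑-distrib-+ (λ l → q * (same k i * same l j)) (weight k))
               (∑-distrib-+ (λ k → ∑[ l < q ] (q * (same k i * same l j))) (λ k → ∑[ l < q ] weight k l)) ⟩
    ∑[ k < q ] ∑[ l < q ] (q * (same k i * same l j)) + ∑[ k < q ] ∑[ l < q ] weight k l
      ≡⟨ cong₂ _+_ diagonal ∑-weight ⟩
    q * (∑[ k < q ] same k i * ∑[ l < q ] same l j) + ∣ A ∣ * ∣ A ∣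
      ≤⟨ +-monoˡ-≤ (∣ A ∣ * ∣ A ∣) (*-monoʳ-≤ q (*-mono-≤ (sum-𝟙-≟-≤1 i) (sum-𝟙-≟-≤1 j))) ⟩
    q * 1 + ∣ A ∣ * ∣ A ∣
      ≡⟨ cong (_+ ∣ A ∣ * ∣ A ∣) (*-identityʳ q) ⟩
    q + ∣ A ∣ * ∣ A ∣ ∎
    where
    diagonal : ∑[ k < q ] ∑[ l < q ] (q * (same k i * same l j)) ≡ q * (∑[ k < q ] same k i * ∑[ l < q ] same l j)
    diagonal = sym (trans (cong (q *_) (sum-*-sum (λ k → same k i) (λ l → same l j)))
      (trans (*-distribˡ-sum q (λ k → ∑[ l < q ] (same k i * same l j)))
             (sum-cong-≗ λ k → *-distribˡ-sum q (λ l → same k i * same l j))))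

  ∑-energy : ∑[ t < q ] energy t ≤ (∣ A ∣ * ∣ A ∣) * (q + ∣ A ∣ * ∣ A ∣)
  ∑-energy = begin
    ∑[ t < q ] energy t
      ≡⟨ sum-cong-≗ (λ t → ∑-fibre² weight (point t)) ⟩
    ∑[ t < q ] ∑[ i < q ] ∑[ j < q ] (weight i j * rep t (point t i j))
      ≡⟨ ∑-comm₂ (λ t i j → weight i j * rep t (point t i j)) ⟩
    ∑[ i < q ] ∑[ j < q ] ∑[ t < q ] (weight i j * rep t (point t i j))
      ≡⟨ sum-cong-≗ (λ i → sum-cong-≗ λ j → *-distribˡ-sum (weight i j) (λ t → rep t (point t i j))) ⟨
    ∑[ i < q ] ∑[ j < q ] (weight i j * ∑[ t < q ] rep t (point t i j))
      ≤⟨ sum-mono-≤ (λ i → sum-mono-≤ λ j → *-monoʳ-≤ (weight i j) (∑-rep-at-point i j)) ⟩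
    ∑[ i < q ] ∑[ j < q ] (weight i j * (q + ∣ A ∣ * ∣ A ∣))
      ≡⟨ trans (*-distribʳ-sum (q + ∣ A ∣ * ∣ A ∣) (λ i → ∑[ j < q ] weight i j))
           (sum-cong-≗ λ i → *-distribʳ-sum (q + ∣ A ∣ * ∣ A ∣) (weight i)) ⟨
    ∑[ i < q ] ∑[ j < q ] weight i j * (q + ∣ A ∣ * ∣ A ∣)
      ≡⟨ cong (_* (q + ∣ A ∣ * ∣ A ∣)) ∑-weight ⟩
    (∣ A ∣ * ∣ A ∣) * (q + ∣ A ∣ * ∣ A ∣) ∎

  large-A+θA : (Θ : Subset q) → ∣ A ∣ ^ 2 * ∣ Θ ∣ > q ^ 2 → ∃ λ θ → θ ∈ Θ × 2 * ∣ A+θA θ ∣ > q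
  large-A+θA Θ many = exists-large-of-energy (∣ A ∣ * ∣ A ∣) energy (∣_∣ ∘ A+θA) Θ
    energy-lower (∣p∣≤n ∘ A+θA) ∑-energy (subst₂ _<_ (square q) (cong (_* ∣ Θ ∣) (square ∣ A ∣)) many)
    where
    square : ∀ n → n ^ 2 ≡ n * n
    square n = cong (n *_) (*-identityʳ n)

  large-aA+A : ∣ A ∣ ^ 3 > q ^ 2 → ∃ λ a → a ∈ A × 2 * ∣ linComb F (elem a) A 1# A ∣ > q
  large-aA+A many =
    let a , a∈A , large = large-A+θA A (subst (q ^ 2 <_) (*-comm ∣ A ∣ (∣ A ∣ ^ 2)) many) in
    a , a∈A , <-≤-trans large (*-monoʳ-≤ 2 (p⊆q⇒∣p∣≤∣q∣ (linComb-comm 1# A (elem a) A)))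

  large-aA+bA : ∣ A ∣ ^ 2 * ∣ ratioSet F A ∣ > q ^ 2 →
                ∃₂ λ a b → a ∈ A × b ∈ A × 2 * ∣ linComb F (elem a) A (elem b) A ∣ > q
  large-aA+bA many =
    let θ , θ∈AA⁻¹ , large = large-A+θA (ratioSet F A) many
        a , b , a∈A , b∈A , b≉0 , θb≈a = ∈-ratioSet⁻ θ∈AA⁻¹
    in
    b , a , b∈A , a∈A , <-≤-trans large (*-monoʳ-≤ 2 (∣p∣≤∣q∣-permute (*-permutation b≉0)
      (linComb-*-permutation b≉0 (𝔽.*-identityʳ (elem b)) (𝔽.trans (𝔽.*-comm (elem b) (elem θ)) θb≈a))))

theorem6 : ∀ {q : ℕ} (F : FiniteField q) (A : Subset q) →
    ((Θ : Subset q) → ∣ A ∣ ^ 2 * ∣ Θ ∣ > q ^ 2 →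
       ∃ λ θ → θ ∈ Θ ×
         2 * ∣ linComb F (FiniteField.1# F) A (FiniteField.elem F θ) A ∣ > q)
    × (∣ A ∣ ^ 3 > q ^ 2 →
       ∃ λ a → a ∈ A ×
         2 * ∣ linComb F (FiniteField.elem F a) A (FiniteField.1# F) A ∣ > q)
    × (∣ A ∣ ^ 2 * ∣ ratioSet F A ∣ > q ^ 2 →
       ∃₂ λ a b → a ∈ A × b ∈ A ×
         2 * ∣ linComb F (FiniteField.elem F a) A (FiniteField.elem F b) A ∣ > q)
theorem6 F A = large-A+θA , large-aA+A , large-aA+bA
  where open Dilations F A
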